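{- For every integer $r\ge 0$, $$\sum_{k=0}^{6r}(-1)^k\binom{2r}{k}_3^2=(-1)^r\binom{4r}{r}.$$
   Context: $\binom{N}{k}_3$ denotes the coefficient of $t^k$ in $(1+t+t^2+t^3)^N$; $\binom{4r}{r}$ is the ordinary binomial coefficient. -}

module Defs where

open import Data.Nat using (ℕ; zero; suc; _+_; _*_)
open import Data.List using (List; []; _∷_)
open import Data.Integer using (ℤ; +_; -_)
import Data.Integer as ℤ

-- Polynomials with natural coefficients as coefficient lists (lowest degree first).
Poly : Set
Poly = List ℕ

coeff : Poly → ℕ → ℕ
coeff []       _       = 0
coeff (a ∷ _)  zero    = a
coeff (_ ∷ p)  (suc k) = coeff p k

addP : Poly → Poly → Poly
addP []       q        = q
addP p        []       = p
addP (a ∷ p)  (b ∷ q)  = (a + b) ∷ addP p q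

scaleP : ℕ → Poly → Poly
scaleP c []      = []
scaleP c (a ∷ p) = (c * a) ∷ scaleP c p

mulP : Poly → Poly → Poly
mulP []       q = []
mulP (a ∷ p)  q = addP (scaleP a q) (0 ∷ mulP p q)

quad : Poly
quad = 1 ∷ 1 ∷ 1 ∷ 1 ∷ []

powP : Poly → ℕ → Poly
powP p zero    = 1 ∷ []
powP p (suc n) = mulP p (powP p n)

binom3 : ℕ → ℕ → ℕ
binom3 N k = coeff (powP quad N) k

sgn : ℕ → ℤ
sgn zero    = + 1
sgn (suc k) = - sgn k

sumTo : ℕ → (ℕ → ℤ) → ℤ
sumTo zero    f = f 0
sumTo (suc n) f = sumTo n f ℤ.+ f (suc n)

module Submission where

-- Let F = (1 + t + t² + t³)^{2r}. F is palindromic of degree 6r, so the sum is the coefficient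
-- of t^{6r} in F(−t) F(t) = ((1 − t²)(1 + t²)²)^{2r}. Write c(a, b) for the coefficient of
-- t^{2(a+b)} in (1 − t²)^{2a} (1 + t²)^{2b}; the sum is c(r, 2r). From (1 + t²)² − (1 − t²)² = 4t²
-- and from the Euler operator t d/dt one gets c(a, b+1) − c(a+1, b) = 4 c(a, b) and
-- (2a+1) c(a, b+1) + (2b+1) c(a+1, b) = 0, which force c(a, b) a! b! (a+b)! = (−1)^a (2a)! (2b)!.
-- At (a, b) = (r, 2r) this is (−1)^r (4r choose r).

open import Defs

module FormalPowerSeries where

  open import Data.Nat.Base using (ℕ; zero; suc)
  open import Data.Integer.Base using (ℤ; -_; _+_; _*_; 0ℤ; 1ℤ)
  import Data.Integer.Properties as ℤ
  open import Data.Integer.Tactic.RingSolver using (solve-∀)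
  open import Data.Maybe.Base using (Maybe; just; nothing)
  open import Data.Product.Base using (_,_)
  open import Relation.Binary.PropositionalEquality
  open import Relation.Nullary.Decidable.Core using (yes; no)
  import Relation.Binary.Reasoning.Setoid as SetoidReasoning
  open import Algebra.Bundles using (CommutativeRing)
  import Algebra.Construct.Pointwise ℕ as Pointwise
  open import Algebra.Properties.CommutativeSemigroup ℤ.+-commutativeSemigroup using (interchange)
  import Algebra.Properties.CommutativeSemiring.Exp as Exp
  import Algebra.Properties.Ring as RingProperties
  open import Algebra.Solver.Ring.AlmostCommutativeRing using (fromCommutativeRing; _-Raw-AlmostCommutative⟶_)
  import Algebra.Solver.Ring as RingSolver

  Series : Set
  Series = ℕ → ℤ

  infix 4 _≋_
  _≋_ : Series → Series → Set
  f ≋ g = ∀ k → f k ≡ g k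

  infixl 6 _⊕_
  infixl 7 _⊛_
  infix 8 ⊝_

  _⊕_ : Series → Series → Series
  (f ⊕ g) k = f k + g k

  ⊝_ : Series → Series
  (⊝ f) k = - f k

  const : ℤ → Series
  const c zero    = c
  const c (suc _) = 0ℤ

  -- Not const 0ℤ: this way tail (const c) is definitionally 𝟘.
  𝟘 : Series
  𝟘 _ = 0ℤ

  𝟙 : Series
  𝟙 = const 1ℤ

  infixr 8 _·_
  _·_ : ℤ → Series → Series
  (c · f) k = c * f k

  tail : Series → Series
  tail f k = f (suc k)

  shift : Series → Series
  shift f zero    = 0ℤ
  shift f (suc k) = f k

  shift-cong : ∀ {f g} → f ≋ g → shift f ≋ shift g
  shift-cong f≋g zero    = refl
  shift-cong f≋g (suc k) = f≋g k

  _⊛_ : Series → Series → Series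
  (f ⊛ g) zero    = f 0 * g 0
  (f ⊛ g) (suc k) = f 0 * g (suc k) + (tail f ⊛ g) k

  ⊛-cong : ∀ {f f′ g g′} → f ≋ f′ → g ≋ g′ → f ⊛ g ≋ f′ ⊛ g′
  ⊛-cong f≋f′ g≋g′ zero    = cong₂ _*_ (f≋f′ 0) (g≋g′ 0)
  ⊛-cong f≋f′ g≋g′ (suc k) =
    cong₂ _+_ (cong₂ _*_ (f≋f′ 0) (g≋g′ (suc k))) (⊛-cong (λ j → f≋f′ (suc j)) g≋g′ k)

  ⊛-zeroˡ : ∀ g → 𝟘 ⊛ g ≋ 𝟘
  ⊛-zeroˡ g zero    = ℤ.*-zeroˡ (g 0)
  ⊛-zeroˡ g (suc k) = cong₂ _+_ (ℤ.*-zeroˡ (g (suc k))) (⊛-zeroˡ g k)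

  const-⊛ : ∀ c g k → (const c ⊛ g) k ≡ c * g k
  const-⊛ c g zero    = refl
  const-⊛ c g (suc k) = trans (cong (c * g (suc k) +_) (⊛-zeroˡ g k)) (ℤ.+-identityʳ _)

  ⊛-distribˡ : ∀ f g h → f ⊛ (g ⊕ h) ≋ f ⊛ g ⊕ f ⊛ h
  ⊛-distribˡ f g h zero    = ℤ.*-distribˡ-+ (f 0) (g 0) (h 0)
  ⊛-distribˡ f g h (suc k) = begin
    f 0 * (g (suc k) + h (suc k)) + (tail f ⊛ (g ⊕ h)) k
      ≡⟨ cong₂ _+_ (ℤ.*-distribˡ-+ (f 0) (g (suc k)) (h (suc k))) (⊛-distribˡ (tail f) g h k) ⟩
    (f 0 * g (suc k) + f 0 * h (suc k)) + ((tail f ⊛ g) k + (tail f ⊛ h) k)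
      ≡⟨ interchange (f 0 * g (suc k)) (f 0 * h (suc k)) _ _ ⟩
    (f ⊛ g ⊕ f ⊛ h) (suc k) ∎
    where open ≡-Reasoning

  ⊛-const : ∀ f c k → (f ⊛ const c) k ≡ c * f k
  ⊛-const f c zero    = ℤ.*-comm (f 0) c
  ⊛-const f c (suc k) = begin
    f 0 * 0ℤ + (tail f ⊛ const c) k ≡⟨ cong₂ _+_ (ℤ.*-zeroʳ (f 0)) (⊛-const (tail f) c k) ⟩
    0ℤ + c * f (suc k)              ≡⟨ ℤ.+-identityˡ _ ⟩
    c * f (suc k)                   ∎
    where open ≡-Reasoning

  ⊛-shift : ∀ f g → f ⊛ shift g ≋ shift (f ⊛ g)
  ⊛-shift f g zero          = ℤ.*-zeroʳ (f 0)
  ⊛-shift f g (suc zero)    = trans (cong (f 0 * g 0 +_) (⊛-shift (tail f) g 0)) (ℤ.+-identityʳ _)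
  ⊛-shift f g (suc (suc k)) = cong (f 0 * g (suc k) +_) (⊛-shift (tail f) g (suc k))

  const-head+shift-tail : ∀ g → g ≋ const (g 0) ⊕ shift (tail g)
  const-head+shift-tail g zero    = sym (ℤ.+-identityʳ _)
  const-head+shift-tail g (suc k) = sym (ℤ.+-identityˡ _)

  ⊛-comm : ∀ f g → f ⊛ g ≋ g ⊛ f
  ⊛-comm f g zero    = ℤ.*-comm (f 0) (g 0)
  ⊛-comm f g (suc k) = begin
    (f ⊛ g) (suc k)
      ≡⟨ ⊛-cong {f} (λ _ → refl) (const-head+shift-tail g) (suc k) ⟩
    (f ⊛ (const (g 0) ⊕ shift (tail g))) (suc k)
      ≡⟨ ⊛-distribˡ f (const (g 0)) (shift (tail g)) (suc k) ⟩
    (f ⊛ const (g 0)) (suc k) + (f ⊛ shift (tail g)) (suc k)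
      ≡⟨ cong₂ _+_ (⊛-const f (g 0) (suc k)) (⊛-shift f (tail g) (suc k)) ⟩
    g 0 * f (suc k) + (f ⊛ tail g) k
      ≡⟨ cong (g 0 * f (suc k) +_) (⊛-comm f (tail g) k) ⟩
    (g ⊛ f) (suc k)
      ∎
    where open ≡-Reasoning

  ⊛-distribʳ : ∀ h f g → (f ⊕ g) ⊛ h ≋ f ⊛ h ⊕ g ⊛ h
  ⊛-distribʳ h f g k = begin
    ((f ⊕ g) ⊛ h) k          ≡⟨ ⊛-comm (f ⊕ g) h k ⟩
    (h ⊛ (f ⊕ g)) k          ≡⟨ ⊛-distribˡ h f g k ⟩
    (h ⊛ f) k + (h ⊛ g) k    ≡⟨ cong₂ _+_ (⊛-comm h f k) (⊛-comm h g k) ⟩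
    (f ⊛ h) k + (g ⊛ h) k    ∎
    where open ≡-Reasoning

  ·-⊛ : ∀ c f g → c · f ⊛ g ≋ c · (f ⊛ g)
  ·-⊛ c f g zero    = ℤ.*-assoc c (f 0) (g 0)
  ·-⊛ c f g (suc k) = begin
    c * f 0 * g (suc k) + (c · tail f ⊛ g) k   ≡⟨ cong₂ _+_ (ℤ.*-assoc c (f 0) (g (suc k))) (·-⊛ c (tail f) g k) ⟩
    c * (f 0 * g (suc k)) + c * (tail f ⊛ g) k ≡⟨ ℤ.*-distribˡ-+ c _ _ ⟨
    c * (f ⊛ g) (suc k)                        ∎
    where open ≡-Reasoning

  ⊛-assoc : ∀ f g h → (f ⊛ g) ⊛ h ≋ f ⊛ (g ⊛ h)
  ⊛-assoc f g h zero    = ℤ.*-assoc (f 0) (g 0) (h 0)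
  ⊛-assoc f g h (suc k) = begin
    (f 0 * g 0) * h (suc k) + ((f 0 · tail g ⊕ tail f ⊛ g) ⊛ h) k
      ≡⟨ cong (f 0 * g 0 * h (suc k) +_) (⊛-distribʳ h (f 0 · tail g) (tail f ⊛ g) k) ⟩
    (f 0 * g 0) * h (suc k) + ((f 0 · tail g ⊛ h) k + ((tail f ⊛ g) ⊛ h) k)
      ≡⟨ cong (f 0 * g 0 * h (suc k) +_) (cong₂ _+_ (·-⊛ (f 0) (tail g) h k) (⊛-assoc (tail f) g h k)) ⟩
    (f 0 * g 0) * h (suc k) + (f 0 * (tail g ⊛ h) k + (tail f ⊛ (g ⊛ h)) k)
      ≡⟨ regroup (f 0) (g 0) (h (suc k)) _ _ ⟩
    f 0 * (g 0 * h (suc k) + (tail g ⊛ h) k) + (tail f ⊛ (g ⊛ h)) k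
      ∎
    where
    open ≡-Reasoning
    regroup : ∀ a b c d e → (a * b) * c + (a * d + e) ≡ a * (b * c + d) + e
    regroup = solve-∀

  ⊛-identityˡ : ∀ f → 𝟙 ⊛ f ≋ f
  ⊛-identityˡ f k = trans (const-⊛ 1ℤ f k) (ℤ.*-identityˡ (f k))

  ⊛-identityʳ : ∀ f → f ⊛ 𝟙 ≋ f
  ⊛-identityʳ f k = trans (⊛-comm f 𝟙 k) (⊛-identityˡ f k)

  commutativeRing : CommutativeRing _ _
  commutativeRing = record
    { Carrier           = Series
    ; _≈_               = _≋_
    ; _+_               = _⊕_
    ; _*_               = _⊛_
    ; -_                = ⊝_
    ; 0#                = 𝟘
    ; 1#                = 𝟙
    ; isCommutativeRing = record
      { isRing = record
        { +-isAbelianGroup = Pointwise.isAbelianGroup ℤ.+-0-isAbelianGroup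
        ; *-cong           = ⊛-cong
        ; *-assoc          = ⊛-assoc
        ; *-identity       = ⊛-identityˡ , ⊛-identityʳ
        ; distrib          = ⊛-distribˡ , ⊛-distribʳ
        }
      ; *-comm = ⊛-comm
      }
    }

  open CommutativeRing commutativeRing public
    using ()
    renaming ( refl to ≋-refl; sym to ≋-sym; trans to ≋-trans
             ; +-cong to ⊕-cong; +-congˡ to ⊕-congˡ; +-congʳ to ⊕-congʳ; -‿cong to ⊝-cong )
  open Exp (CommutativeRing.commutativeSemiring commutativeRing) public
    using (_^_; ^-distrib-*; ^-assocʳ; ^-congˡ)
  open RingProperties (CommutativeRing.ring commutativeRing) public
    using (-‿distribˡ-*)
  module ≋-Reasoning = SetoidReasoning (CommutativeRing.setoid commutativeRing)

  const-+ : ∀ a b → const (a + b) ≋ const a ⊕ const b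
  const-+ a b zero    = refl
  const-+ a b (suc k) = refl

  const-homomorphism : CommutativeRing.rawRing ℤ.+-*-commutativeRing -Raw-AlmostCommutative⟶ fromCommutativeRing commutativeRing
  const-homomorphism = record
    { ⟦_⟧    = const
    ; +-homo = const-+
    ; *-homo = λ { a b zero → refl ; a b (suc k) → sym (trans (const-⊛ a (const b) (suc k)) (ℤ.*-zeroʳ a)) }
    ; -‿homo = λ { a zero → refl ; a (suc k) → refl }
    ; 0-homo = λ { zero → refl ; (suc k) → refl }
    ; 1-homo = λ k → refl
    }

  const-≟ : ∀ a b → Maybe (const a ≋ const b)
  const-≟ a b with a ℤ.≟ b
  ... | yes a≡b = just λ k → cong (λ c → const c k) a≡b
  ... | no _    = nothing

  open RingSolver (CommutativeRing.rawRing ℤ.+-*-commutativeRing) (fromCommutativeRing commutativeRing) const-homomorphism const-≟ public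
    using (solve; _:=_; _:+_; _:*_; _:^_; :-_; con)

  t : Series
  t = shift 𝟙

  t-⊛ : ∀ f → t ⊛ f ≋ shift f
  t-⊛ f k = begin
    (t ⊛ f) k             ≡⟨ ⊛-comm t f k ⟩
    (f ⊛ shift 𝟙) k       ≡⟨ ⊛-shift f 𝟙 k ⟩
    shift (f ⊛ 𝟙) k       ≡⟨ shift-cong (⊛-identityʳ f) k ⟩
    shift f k             ∎
    where open ≡-Reasoning

  shiftBy : ℕ → Series → Series
  shiftBy zero    f = f
  shiftBy (suc m) f = shift (shiftBy m f)

  t^-⊛ : ∀ m f → t ^ m ⊛ f ≋ shiftBy m f
  t^-⊛ zero    f k = ⊛-identityˡ f k
  t^-⊛ (suc m) f k = begin
    ((t ⊛ t ^ m) ⊛ f) k     ≡⟨ ⊛-assoc t (t ^ m) f k ⟩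
    (t ⊛ (t ^ m ⊛ f)) k     ≡⟨ t-⊛ (t ^ m ⊛ f) k ⟩
    shift (t ^ m ⊛ f) k     ≡⟨ shift-cong (t^-⊛ m f) k ⟩
    shiftBy (suc m) f k     ∎
    where open ≡-Reasoning

  t^≋shiftBy : ∀ m → t ^ m ≋ shiftBy m 𝟙
  t^≋shiftBy m = ≋-trans (≋-sym (⊛-identityʳ (t ^ m))) (t^-⊛ m 𝟙)

module Alternation where

  open import Data.Nat.Base using (zero; suc)
  open import Data.Integer.Base using (ℤ; -_; _+_; _*_; 1ℤ)
  import Data.Integer.Properties as ℤ
  open import Data.Integer.Tactic.RingSolver using (solve-∀)
  open import Relation.Binary.PropositionalEquality
  open FormalPowerSeries

  alternate : Series → Series
  alternate f k = sgn k * f k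

  alternate-cong : ∀ {f g} → f ≋ g → alternate f ≋ alternate g
  alternate-cong f≋g k = cong (sgn k *_) (f≋g k)

  alternate-⊕ : ∀ f g → alternate (f ⊕ g) ≋ alternate f ⊕ alternate g
  alternate-⊕ f g k = ℤ.*-distribˡ-+ (sgn k) (f k) (g k)

  alternate-𝟙 : alternate 𝟙 ≋ 𝟙
  alternate-𝟙 zero    = refl
  alternate-𝟙 (suc k) = ℤ.*-zeroʳ (sgn (suc k))

  alternate-t : alternate t ≋ ⊝ t
  alternate-t zero          = refl
  alternate-t (suc zero)    = refl
  alternate-t (suc (suc k)) = ℤ.*-zeroʳ (sgn (suc (suc k)))

  tail-alternate : ∀ f → tail (alternate f) ≋ ⊝ alternate (tail f)
  tail-alternate f k = sym (ℤ.neg-distribˡ-* (sgn k) (f (suc k)))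

  alternate-⊛ : ∀ f g → alternate (f ⊛ g) ≋ alternate f ⊛ alternate g
  alternate-⊛ f g zero    = regroup (f 0) (g 0)
    where
    regroup : ∀ a b → 1ℤ * (a * b) ≡ (1ℤ * a) * (1ℤ * b)
    regroup = solve-∀
  alternate-⊛ f g (suc k) = begin
    - sgn k * (f 0 * g (suc k) + (tail f ⊛ g) k)  ≡⟨ regroup (sgn k) (f 0) (g (suc k)) ((tail f ⊛ g) k) ⟩
    lead + - (sgn k * (tail f ⊛ g) k)             ≡⟨ cong (λ x → lead + - x) (alternate-⊛ (tail f) g k) ⟩
    lead + - (alternate (tail f) ⊛ alternate g) k ≡⟨ cong (lead +_) (-‿distribˡ-* (alternate (tail f)) (alternate g) k) ⟩
    lead + (⊝ alternate (tail f) ⊛ alternate g) k ≡⟨ cong (lead +_) (⊛-cong (tail-alternate f) ≋-refl k) ⟨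
    (alternate f ⊛ alternate g) (suc k)           ∎
    where
    open ≡-Reasoning
    lead : ℤ
    lead = (sgn 0 * f 0) * (- sgn k * g (suc k))
    regroup : ∀ s a b c → (- s) * (a * b + c) ≡ (1ℤ * a) * ((- s) * b) + - (s * c)
    regroup = solve-∀

  alternate-^ : ∀ f n → alternate (f ^ n) ≋ alternate f ^ n
  alternate-^ f zero    = alternate-𝟙
  alternate-^ f (suc n) = ≋-trans (alternate-⊛ f (f ^ n)) (⊛-cong {alternate f} ≋-refl (alternate-^ f n))

module EulerOperator where

  open import Data.Nat.Base using (zero; suc)
  open import Data.Integer.Base using (ℤ; +_; _+_; _*_; 0ℤ; 1ℤ)
  import Data.Integer.Properties as ℤ
  open import Data.Integer.Tactic.RingSolver using (solve-∀)
  open import Relation.Binary.PropositionalEquality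
  open FormalPowerSeries

  euler : Series → Series
  euler f k = + k * f k

  euler-⊕ : ∀ f g → euler (f ⊕ g) ≋ euler f ⊕ euler g
  euler-⊕ f g k = ℤ.*-distribˡ-+ (+ k) (f k) (g k)

  euler-⊝ : ∀ f → euler (⊝ f) ≋ ⊝ euler f
  euler-⊝ f k = sym (ℤ.neg-distribʳ-* (+ k) (f k))

  euler-𝟙 : euler 𝟙 ≋ const 0ℤ
  euler-𝟙 zero    = refl
  euler-𝟙 (suc k) = ℤ.*-zeroʳ (+ suc k)

  euler-t : euler t ≋ t
  euler-t zero          = refl
  euler-t (suc zero)    = refl
  euler-t (suc (suc k)) = ℤ.*-zeroʳ (+ suc (suc k))

  tail-euler : ∀ f → tail (euler f) ≋ tail f ⊕ euler (tail f)
  tail-euler f k = ℤ.suc-* (+ k) (f (suc k))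

  euler-⊛ : ∀ f g → euler (f ⊛ g) ≋ euler f ⊛ g ⊕ f ⊛ euler g
  euler-⊛ f g zero    = regroup (f 0) (g 0)
    where
    regroup : ∀ a b → 0ℤ * (a * b) ≡ (0ℤ * a) * b + a * (0ℤ * b)
    regroup = solve-∀
  euler-⊛ f g (suc k) = begin
    (1ℤ + + k) * (f 0 * g (suc k) + P)                 ≡⟨ expand (+ k) (f 0) (g (suc k)) P ⟩
    lead + (P + + k * P) + G                           ≡⟨ cong (λ x → lead + (P + x) + G) (euler-⊛ (tail f) g k) ⟩
    lead + (P + (E + F)) + G                           ≡⟨ regroup lead P E F G ⟩
    lead + (P + E) + (G + F)                           ≡⟨ cong (λ x → lead + x + (G + F)) (⊛-distribʳ g (tail f) (euler (tail f)) k) ⟨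
    lead + ((tail f ⊕ euler (tail f)) ⊛ g) k + (G + F) ≡⟨ cong (λ x → lead + x + (G + F)) (⊛-cong (tail-euler f) ≋-refl k) ⟨
    (euler f ⊛ g ⊕ f ⊛ euler g) (suc k)                ∎
    where
    open ≡-Reasoning
    P E F G lead : ℤ
    P    = (tail f ⊛ g) k
    E    = (euler (tail f) ⊛ g) k
    F    = (tail f ⊛ euler g) k
    G    = f 0 * ((1ℤ + + k) * g (suc k))
    lead = (0ℤ * f 0) * g (suc k)
    expand : ∀ k a b p → (1ℤ + k) * (a * b + p) ≡ (0ℤ * a) * b + (p + k * p) + a * ((1ℤ + k) * b)
    expand = solve-∀
    regroup : ∀ l p e f q → l + (p + (e + f)) + q ≡ l + (p + e) + (q + f)
    regroup = solve-∀

  euler-^ : ∀ f m → euler (f ^ suc m) ≋ const (+ suc m) ⊛ (euler f ⊛ f ^ m)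
  euler-^ f zero    = begin
    euler (f ⊛ 𝟙)               ≈⟨ euler-⊛ f 𝟙 ⟩
    euler f ⊛ 𝟙 ⊕ f ⊛ euler 𝟙   ≈⟨ ⊕-congˡ {euler f ⊛ 𝟙} (⊛-cong {f} ≋-refl euler-𝟙) ⟩
    euler f ⊛ 𝟙 ⊕ f ⊛ const 0ℤ  ≈⟨ solve 2 (λ e x → e :* con 1ℤ :+ x :* con 0ℤ := con 1ℤ :* (e :* con 1ℤ)) ≋-refl (euler f) f ⟩
    𝟙 ⊛ (euler f ⊛ 𝟙)           ∎
    where open ≋-Reasoning
  euler-^ f (suc m) = begin
    euler (f ⊛ f ^ suc m)
      ≈⟨ euler-⊛ f (f ^ suc m) ⟩
    euler f ⊛ f ^ suc m ⊕ f ⊛ euler (f ^ suc m)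
      ≈⟨ ⊕-congˡ {euler f ⊛ f ^ suc m} (⊛-cong {f} ≋-refl (euler-^ f m)) ⟩
    euler f ⊛ (f ⊛ f ^ m) ⊕ f ⊛ (const (+ suc m) ⊛ (euler f ⊛ f ^ m))
      ≈⟨ solve 4 (λ e x p c → e :* (x :* p) :+ x :* (c :* (e :* p)) := (con 1ℤ :+ c) :* (e :* (x :* p)))
               ≋-refl (euler f) f (f ^ m) (const (+ suc m)) ⟩
    (𝟙 ⊕ const (+ suc m)) ⊛ (euler f ⊛ f ^ suc m)
      ≈⟨ ⊛-cong (const-+ 1ℤ (+ suc m)) ≋-refl ⟨
    const (+ suc (suc m)) ⊛ (euler f ⊛ f ^ suc m)
      ∎
    where open ≋-Reasoning

module Palindromes where

  open import Data.Nat.Base as ℕ using (ℕ; zero; suc; _<_; s≤s)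
  import Data.Nat.Properties as ℕ
  open import Data.Integer.Base using (_+_; 0ℤ)
  import Data.Integer.Properties as ℤ
  open import Relation.Binary.PropositionalEquality
  open FormalPowerSeries

  record Palindromic (d : ℕ) (f : Series) : Set where
    field
      mirror : ∀ i j → i ℕ.+ j ≡ d → f i ≡ f j
      vanish : ∀ k → d < k → f k ≡ 0ℤ

  open Palindromic

  palindromic-cong : ∀ {d f g} → f ≋ g → Palindromic d f → Palindromic d g
  palindromic-cong f≋g pal = record
    { mirror = λ i j i+j≡d → trans (sym (f≋g i)) (trans (mirror pal i j i+j≡d) (f≋g j))
    ; vanish = λ k d<k → trans (sym (f≋g k)) (vanish pal k d<k)
    }

  𝟙-palindromic : Palindromic 0 𝟙
  𝟙-palindromic = record
    { mirror = λ { zero zero _ → refl ; zero (suc j) () ; (suc i) j () }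
    ; vanish = λ { (suc k) _ → refl }
    }

  shiftBy-vanish : ∀ {d f} → Palindromic d f → ∀ m k → d ℕ.+ m < k → shiftBy m f k ≡ 0ℤ
  shiftBy-vanish {d} pal zero    k       d+0<k = vanish pal k (subst (_< k) (ℕ.+-identityʳ d) d+0<k)
  shiftBy-vanish     pal (suc m) zero    _     = refl
  shiftBy-vanish {d} pal (suc m) (suc k) d+m+1<k+1 =
    shiftBy-vanish pal m k (ℕ.≤-pred (subst (_< suc k) (ℕ.+-suc d m) d+m+1<k+1))

  shiftBy-mirror : ∀ {d f} → Palindromic d f →
    ∀ m m′ i j → i ℕ.+ j ≡ d ℕ.+ (m ℕ.+ m′) → shiftBy m f i ≡ shiftBy m′ f j
  shiftBy-mirror {d} pal zero    zero     i       j       eq = mirror pal i j (trans eq (ℕ.+-identityʳ d))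
  shiftBy-mirror {d} pal (suc m) m′       zero    j       eq =
    sym (shiftBy-vanish pal m′ j (subst (d ℕ.+ m′ <_) (sym eq) (ℕ.+-monoʳ-< d (s≤s (ℕ.m≤n+m m′ m)))))
  shiftBy-mirror {d} pal (suc m) m′       (suc i) j       eq =
    shiftBy-mirror pal m m′ i j (ℕ.suc-injective (trans eq (ℕ.+-suc d (m ℕ.+ m′))))
  shiftBy-mirror {d} pal zero    (suc m′) i       zero    eq =
    shiftBy-vanish pal 0 i (subst (d ℕ.+ 0 <_) (trans (sym eq) (ℕ.+-identityʳ i)) (ℕ.+-monoʳ-< d (s≤s ℕ.z≤n)))
  shiftBy-mirror {d} pal zero    (suc m′) i       (suc j) eq =
    shiftBy-mirror pal zero m′ i j (ℕ.suc-injective (trans (sym (ℕ.+-suc i j)) (trans eq (ℕ.+-suc d m′))))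

  palindromic-⊕-shiftBy : ∀ {d f} m → Palindromic d f → Palindromic (m ℕ.+ d) (f ⊕ shiftBy m f)
  palindromic-⊕-shiftBy {d} {f} m pal = record
    { mirror = λ i j i+j≡m+d → begin
        f i + shiftBy m f i ≡⟨ cong₂ _+_ (shiftBy-mirror pal 0 m i j (trans i+j≡m+d (ℕ.+-comm m d)))
                                         (shiftBy-mirror pal m 0 i j (trans i+j≡m+d (trans (ℕ.+-comm m d) (cong (d ℕ.+_) (sym (ℕ.+-identityʳ m)))))) ⟩
        shiftBy m f j + f j ≡⟨ ℤ.+-comm (shiftBy m f j) (f j) ⟩
        f j + shiftBy m f j ∎
    ; vanish = λ k m+d<k → cong₂ _+_
        (vanish pal k (ℕ.≤-<-trans (ℕ.m≤n+m d m) m+d<k))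
        (shiftBy-vanish pal m k (subst (_< k) (ℕ.+-comm m d) m+d<k))
    }
    where open ≡-Reasoning

  palindromic-1+t^-⊛ : ∀ {d f} m → Palindromic d f → Palindromic (m ℕ.+ d) ((𝟙 ⊕ t ^ m) ⊛ f)
  palindromic-1+t^-⊛ {f = f} m pal = palindromic-cong (≋-sym 1+t^-⊛) (palindromic-⊕-shiftBy m pal)
    where
    1+t^-⊛ : (𝟙 ⊕ t ^ m) ⊛ f ≋ f ⊕ shiftBy m f
    1+t^-⊛ = ≋-trans (⊛-distribʳ f 𝟙 (t ^ m)) (⊕-cong (⊛-identityˡ f) (t^-⊛ m f))

module Coefficients where

  open import Data.Nat.Base as ℕ using (zero; suc; _∸_; _≤_)
  import Data.Nat.Properties as ℕ
  open import Data.Integer.Base using (+_; _+_; _*_)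
  import Data.Integer.Properties as ℤ
  open import Data.List.Base using ([]; _∷_)
  open import Relation.Binary.PropositionalEquality
  open FormalPowerSeries
  open Alternation
  open Palindromes

  series : Poly → Series
  series p k = + coeff p k

  coeff-addP : ∀ p q k → coeff (addP p q) k ≡ coeff p k ℕ.+ coeff q k
  coeff-addP []      q       k       = refl
  coeff-addP (a ∷ p) []      k       = sym (ℕ.+-identityʳ _)
  coeff-addP (a ∷ p) (b ∷ q) zero    = refl
  coeff-addP (a ∷ p) (b ∷ q) (suc k) = coeff-addP p q k

  coeff-scaleP : ∀ c q k → coeff (scaleP c q) k ≡ c ℕ.* coeff q k
  coeff-scaleP c []      k       = sym (ℕ.*-zeroʳ c)
  coeff-scaleP c (a ∷ q) zero    = refl
  coeff-scaleP c (a ∷ q) (suc k) = coeff-scaleP c q k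

  series-mulP : ∀ p q → series (mulP p q) ≋ series p ⊛ series q
  series-mulP []      q k       = sym (⊛-zeroˡ (series q) k)
  series-mulP (a ∷ p) q zero    = begin
    + coeff (addP (scaleP a q) (0 ∷ mulP p q)) 0  ≡⟨ cong +_ (coeff-addP (scaleP a q) (0 ∷ mulP p q) 0) ⟩
    + (coeff (scaleP a q) 0 ℕ.+ 0)                ≡⟨ cong +_ (trans (ℕ.+-identityʳ _) (coeff-scaleP a q 0)) ⟩
    + (a ℕ.* coeff q 0)                           ≡⟨ ℤ.pos-* a (coeff q 0) ⟩
    + a * series q 0                              ∎
    where open ≡-Reasoning
  series-mulP (a ∷ p) q (suc k) = begin
    + coeff (addP (scaleP a q) (0 ∷ mulP p q)) (suc k)     ≡⟨ cong +_ (coeff-addP (scaleP a q) (0 ∷ mulP p q) (suc k)) ⟩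
    + (coeff (scaleP a q) (suc k) ℕ.+ coeff (mulP p q) k)  ≡⟨ ℤ.pos-+ (coeff (scaleP a q) (suc k)) _ ⟩
    + coeff (scaleP a q) (suc k) + series (mulP p q) k     ≡⟨ cong₂ _+_ (cong +_ (coeff-scaleP a q (suc k))) (series-mulP p q k) ⟩
    + (a ℕ.* coeff q (suc k)) + (series p ⊛ series q) k    ≡⟨ cong (_+ (series p ⊛ series q) k) (ℤ.pos-* a (coeff q (suc k))) ⟩
    + a * series q (suc k) + (series p ⊛ series q) k       ∎
    where open ≡-Reasoning

  series-powP : ∀ p n → series (powP p n) ≋ series p ^ n
  series-powP p zero    zero    = refl
  series-powP p zero    (suc k) = refl
  series-powP p (suc n) = ≋-trans (series-mulP p (powP p n)) (⊛-cong {series p} ≋-refl (series-powP p n))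

  sumTo-suc : ∀ n h → sumTo (suc n) h ≡ h 0 + sumTo n (λ i → h (suc i))
  sumTo-suc zero    h = refl
  sumTo-suc (suc n) h = trans (cong (_+ h (suc (suc n))) (sumTo-suc n h)) (ℤ.+-assoc (h 0) _ _)

  sumTo-cong : ∀ n {g h} → (∀ k → k ≤ n → g k ≡ h k) → sumTo n g ≡ sumTo n h
  sumTo-cong zero    g≡h = g≡h 0 ℕ.z≤n
  sumTo-cong (suc n) g≡h = cong₂ _+_ (sumTo-cong n (λ k k≤n → g≡h k (ℕ.m≤n⇒m≤1+n k≤n))) (g≡h (suc n) ℕ.≤-refl)

  ⊛-sumTo : ∀ f g n → (f ⊛ g) n ≡ sumTo n (λ i → f i * g (n ∸ i))
  ⊛-sumTo f g zero    = refl
  ⊛-sumTo f g (suc n) = trans (cong (_+_ (f 0 * g (suc n))) (⊛-sumTo (tail f) g n))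
                              (sym (sumTo-suc n (λ i → f i * g (suc n ∸ i))))

  alternating-sum-of-squares : ∀ {d f} → Palindromic d f →
    sumTo d (λ k → sgn k * (f k * f k)) ≡ (alternate f ⊛ f) d
  alternating-sum-of-squares {d} {f} pal = begin
    sumTo d (λ k → sgn k * (f k * f k))        ≡⟨ sumTo-cong d mirrored ⟩
    sumTo d (λ k → alternate f k * f (d ∸ k))  ≡⟨ ⊛-sumTo (alternate f) f d ⟨
    (alternate f ⊛ f) d                        ∎
    where
    open ≡-Reasoning
    mirrored : ∀ k → k ≤ d → sgn k * (f k * f k) ≡ alternate f k * f (d ∸ k)
    mirrored k k≤d = trans (sym (ℤ.*-assoc (sgn k) (f k) (f k)))
      (cong (alternate f k *_) (Palindromic.mirror pal k (d ∸ k) (ℕ.m+[n∸m]≡n k≤d)))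

module CentralCoefficients where

  open import Data.Nat.Base as ℕ using (ℕ; zero; suc; _∸_; _≤_; _!)
  import Data.Nat.Properties as ℕ
  open import Data.Nat.Properties using (_!≢0; _!*_!≢0; m*n≢0)
  import Data.Nat.Tactic.RingSolver as ℕ-Solver
  open import Data.Nat.Combinatorics using (_C_; nCk≡n!/k![n-k]!; k![n∸k]!∣n!)
  open import Data.Nat.DivMod using (m/n*n≡m)
  open import Data.Integer.Base using (ℤ; +_; -_; _+_; _*_; 0ℤ; 1ℤ)
  import Data.Integer.Properties as ℤ
  open import Data.Integer.Tactic.RingSolver using (solve-∀)
  open import Data.Product.Base using (_×_; _,_; proj₁; proj₂)
  open import Relation.Binary.PropositionalEquality
  open import Algebra.Properties.AbelianGroup ℤ.+-0-abelianGroup using (identityʳ-unique)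
  open FormalPowerSeries
  open EulerOperator

  U V : Series
  U = 𝟙 ⊕ ⊝ (t ^ 2)
  V = 𝟙 ⊕ t ^ 2

  euler-t² : euler (t ^ 2) ≋ const (+ 2) ⊛ (t ⊛ t ^ 1)
  euler-t² = ≋-trans (euler-^ t 1) (⊛-cong {const (+ 2)} ≋-refl (⊛-cong euler-t ≋-refl))

  euler-U : euler U ≋ U ⊕ ⊝ V
  euler-U = begin
    euler (𝟙 ⊕ ⊝ (t ^ 2))                     ≈⟨ ≋-trans (euler-⊕ 𝟙 (⊝ (t ^ 2))) (⊕-cong euler-𝟙 (euler-⊝ (t ^ 2))) ⟩
    const 0ℤ ⊕ ⊝ euler (t ^ 2)                ≈⟨ ⊕-congˡ {const 0ℤ} (⊝-cong euler-t²) ⟩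
    const 0ℤ ⊕ ⊝ (const (+ 2) ⊛ (t ⊛ t ^ 1))  ≈⟨ solve 1 (λ y → con 0ℤ :+ :- (con (+ 2) :* (y :* y :^ 1))
                                                               := (con 1ℤ :+ :- (y :^ 2)) :+ :- (con 1ℤ :+ y :^ 2)) ≋-refl t ⟩
    U ⊕ ⊝ V                                   ∎
    where open ≋-Reasoning

  euler-V : euler V ≋ V ⊕ ⊝ U
  euler-V = begin
    euler (𝟙 ⊕ t ^ 2)                     ≈⟨ ≋-trans (euler-⊕ 𝟙 (t ^ 2)) (⊕-cong euler-𝟙 euler-t²) ⟩
    const 0ℤ ⊕ const (+ 2) ⊛ (t ⊛ t ^ 1)  ≈⟨ solve 1 (λ y → con 0ℤ :+ con (+ 2) :* (y :* y :^ 1)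
                                                           := (con 1ℤ :+ y :^ 2) :+ :- (con 1ℤ :+ :- (y :^ 2))) ≋-refl t ⟩
    V ⊕ ⊝ U                               ∎
    where open ≋-Reasoning

  central : ℕ → ℕ → ℤ
  central a b = (U ^ (2 ℕ.* a) ⊛ V ^ (2 ℕ.* b)) (2 ℕ.* (a ℕ.+ b))

  2*-suc : ∀ n → 2 ℕ.* suc n ≡ suc (suc (2 ℕ.* n))
  2*-suc n = ℕ.*-suc 2 n

  central-sucˡ : ∀ a b → central (suc a) b ≡ ((U ⊛ (U ⊛ U ^ (2 ℕ.* a))) ⊛ V ^ (2 ℕ.* b)) (2 ℕ.+ 2 ℕ.* (a ℕ.+ b))
  central-sucˡ a b = cong₂ (λ m n → (U ^ m ⊛ V ^ (2 ℕ.* b)) n) (2*-suc a) (2*-suc (a ℕ.+ b))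

  central-sucʳ : ∀ a b → central a (suc b) ≡ (U ^ (2 ℕ.* a) ⊛ (V ⊛ (V ⊛ V ^ (2 ℕ.* b)))) (2 ℕ.+ 2 ℕ.* (a ℕ.+ b))
  central-sucʳ a b = cong₂ (λ m n → (U ^ (2 ℕ.* a) ⊛ V ^ m) n) (2*-suc b) (trans (cong (2 ℕ.*_) (ℕ.+-suc a b)) (2*-suc (a ℕ.+ b)))

  central-difference : ∀ a b → central a (suc b) + - central (suc a) b ≡ + 4 * central a b
  central-difference a b = begin
    central a (suc b) + - central (suc a) b        ≡⟨ cong₂ (λ x y → x + - y) (central-sucʳ a b) (central-sucˡ a b) ⟩
    (P ⊛ (V ⊛ (V ⊛ Q)) ⊕ ⊝ ((U ⊛ (U ⊛ P)) ⊛ Q)) n  ≡⟨ V²-U² n ⟩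
    (const (+ 4) ⊛ (t ^ 2 ⊛ (P ⊛ Q))) n            ≡⟨ const-⊛ (+ 4) (t ^ 2 ⊛ (P ⊛ Q)) n ⟩
    + 4 * (t ^ 2 ⊛ (P ⊛ Q)) n                      ≡⟨ cong (+ 4 *_) (t^-⊛ 2 (P ⊛ Q) n) ⟩
    + 4 * central a b                              ∎
    where
    open ≡-Reasoning
    P Q : Series
    P = U ^ (2 ℕ.* a)
    Q = V ^ (2 ℕ.* b)
    n : ℕ
    n = 2 ℕ.+ 2 ℕ.* (a ℕ.+ b)
    V²-U² : P ⊛ (V ⊛ (V ⊛ Q)) ⊕ ⊝ ((U ⊛ (U ⊛ P)) ⊛ Q) ≋ const (+ 4) ⊛ (t ^ 2 ⊛ (P ⊛ Q))
    V²-U² = solve 3 (λ y p q → p :* ((con 1ℤ :+ y :^ 2) :* ((con 1ℤ :+ y :^ 2) :* q))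
                                 :+ :- ((con 1ℤ :+ :- (y :^ 2)) :* ((con 1ℤ :+ :- (y :^ 2)) :* p) :* q)
                               := con (+ 4) :* (y :^ 2 :* (p :* q))) ≋-refl t P Q

  euler-U^⊛V^ : ∀ m n → euler (U ^ suc m ⊛ V ^ suc n) ≋
    (const (+ suc m) ⊕ const (+ suc n)) ⊛ (U ^ suc m ⊛ V ^ suc n)
      ⊕ ⊝ (const (+ suc m) ⊛ (U ^ m ⊛ V ^ suc (suc n)) ⊕ const (+ suc n) ⊛ (U ^ suc (suc m) ⊛ V ^ n))
  euler-U^⊛V^ m n = begin
    euler (U ^ suc m ⊛ V ^ suc n)
      ≈⟨ euler-⊛ (U ^ suc m) (V ^ suc n) ⟩
    euler (U ^ suc m) ⊛ V ^ suc n ⊕ U ^ suc m ⊛ euler (V ^ suc n)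
      ≈⟨ ⊕-cong (⊛-cong (euler-^ U m) ≋-refl) (⊛-cong {U ^ suc m} ≋-refl (euler-^ V n)) ⟩
    (A ⊛ (euler U ⊛ U ^ m)) ⊛ V ^ suc n ⊕ U ^ suc m ⊛ (B ⊛ (euler V ⊛ V ^ n))
      ≈⟨ ⊕-cong (⊛-cong (⊛-cong {A} ≋-refl (⊛-cong euler-U ≋-refl)) ≋-refl)
                (⊛-cong {U ^ suc m} ≋-refl (⊛-cong {B} ≋-refl (⊛-cong euler-V ≋-refl))) ⟩
    (A ⊛ ((U ⊕ ⊝ V) ⊛ U ^ m)) ⊛ V ^ suc n ⊕ U ^ suc m ⊛ (B ⊛ ((V ⊕ ⊝ U) ⊛ V ^ n))
      ≈⟨ solve 6 (λ a b u v p q →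
             (a :* ((u :+ :- v) :* p)) :* (v :* q) :+ (u :* p) :* (b :* ((v :+ :- u) :* q))
             := (a :+ b) :* ((u :* p) :* (v :* q)) :+ :- (a :* (p :* (v :* (v :* q))) :+ b :* ((u :* (u :* p)) :* q)))
           ≋-refl A B U V (U ^ m) (V ^ n) ⟩
    (A ⊕ B) ⊛ (U ^ suc m ⊛ V ^ suc n) ⊕ ⊝ (A ⊛ (U ^ m ⊛ V ^ suc (suc n)) ⊕ B ⊛ (U ^ suc (suc m) ⊛ V ^ n))
      ∎
    where
    open ≋-Reasoning
    A B : Series
    A = const (+ suc m)
    B = const (+ suc n)

  central-weighted : ∀ a b → + suc (2 ℕ.* a) * central a (suc b) + + suc (2 ℕ.* b) * central (suc a) b ≡ 0ℤ
  central-weighted a b = begin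
    A * central a (suc b) + B * central (suc a) b  ≡⟨ cong₂ (λ x y → A * x + B * y) (central-sucʳ a b) (central-sucˡ a b) ⟩
    A * L₁ n + B * L₂ n                            ≡⟨ ℤ.neg-injective (identityʳ-unique (+ n * R n) _ coefficient-n) ⟩
    0ℤ                                             ∎
    where
    open ≡-Reasoning
    A B : ℤ
    A = + suc (2 ℕ.* a)
    B = + suc (2 ℕ.* b)
    n : ℕ
    n = 2 ℕ.+ 2 ℕ.* (a ℕ.+ b)
    R L₁ L₂ : Series
    R  = U ^ suc (2 ℕ.* a) ⊛ V ^ suc (2 ℕ.* b)
    L₁ = U ^ (2 ℕ.* a) ⊛ V ^ suc (suc (2 ℕ.* b))
    L₂ = U ^ suc (suc (2 ℕ.* a)) ⊛ V ^ (2 ℕ.* b)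
    A+B≡n : A + B ≡ + n
    A+B≡n = cong +_ (trans (ℕ.+-suc (suc (2 ℕ.* a)) (2 ℕ.* b)) (cong (2 ℕ.+_) (sym (ℕ.*-distribˡ-+ 2 a b))))
    coefficient-n : + n * R n + - (A * L₁ n + B * L₂ n) ≡ + n * R n
    coefficient-n = sym (begin
      + n * R n
        ≡⟨ euler-U^⊛V^ (2 ℕ.* a) (2 ℕ.* b) n ⟩
      ((const A ⊕ const B) ⊛ R) n + - ((const A ⊛ L₁) n + (const B ⊛ L₂) n)
        ≡⟨ cong₂ (λ x y → x + - y) (⊛-cong {g = R} (const-+ A B) ≋-refl n) (sym (cong₂ _+_ (const-⊛ A L₁ n) (const-⊛ B L₂ n))) ⟨
      (const (A + B) ⊛ R) n + - (A * L₁ n + B * L₂ n)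
        ≡⟨ cong (λ x → x + - (A * L₁ n + B * L₂ n)) (trans (const-⊛ (A + B) R n) (cong (_* R n) A+B≡n)) ⟩
      + n * R n + - (A * L₁ n + B * L₂ n)
        ∎)

  two-term-recurrence : ∀ A B c x x₀₁ x₁₀ → A + B ≡ + 2 * c → x₀₁ + - x₁₀ ≡ + 4 * x → A * x₀₁ + B * x₁₀ ≡ 0ℤ →
    c * x₁₀ ≡ - (+ 2 * A) * x × c * x₀₁ ≡ + 2 * B * x
  two-term-recurrence A B c x x₀₁ x₁₀ A+B≡2c difference weighted = cancel-2 (begin
      + 2 * (c * x₁₀)                              ≡⟨ ℤ.*-assoc (+ 2) c x₁₀ ⟨
      + 2 * c * x₁₀                                ≡⟨ cong (_* x₁₀) A+B≡2c ⟨
      (A + B) * x₁₀                                ≡⟨ expand₁₀ A B x₀₁ x₁₀ ⟩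
      (A * x₀₁ + B * x₁₀) + - (A * (x₀₁ + - x₁₀))  ≡⟨ cong₂ (λ y z → y + - (A * z)) weighted difference ⟩
      0ℤ + - (A * (+ 4 * x))                       ≡⟨ collect₁₀ A x ⟩
      + 2 * (- (+ 2 * A) * x)                      ∎)
    , cancel-2 (begin
      + 2 * (c * x₀₁)                              ≡⟨ ℤ.*-assoc (+ 2) c x₀₁ ⟨
      + 2 * c * x₀₁                                ≡⟨ cong (_* x₀₁) A+B≡2c ⟨
      (A + B) * x₀₁                                ≡⟨ expand₀₁ A B x₀₁ x₁₀ ⟩
      (A * x₀₁ + B * x₁₀) + B * (x₀₁ + - x₁₀)      ≡⟨ cong₂ (λ y z → y + B * z) weighted difference ⟩
      0ℤ + B * (+ 4 * x)                           ≡⟨ collect₀₁ B x ⟩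
      + 2 * (+ 2 * B * x)                          ∎)
    where
    open ≡-Reasoning
    cancel-2 : ∀ {y z} → + 2 * y ≡ + 2 * z → y ≡ z
    cancel-2 {y} {z} = ℤ.*-cancelˡ-≡ (+ 2) y z
    expand₁₀ : ∀ A B x₀₁ x₁₀ → (A + B) * x₁₀ ≡ (A * x₀₁ + B * x₁₀) + - (A * (x₀₁ + - x₁₀))
    expand₁₀ = solve-∀
    expand₀₁ : ∀ A B x₀₁ x₁₀ → (A + B) * x₀₁ ≡ (A * x₀₁ + B * x₁₀) + B * (x₀₁ + - x₁₀)
    expand₀₁ = solve-∀
    collect₁₀ : ∀ A x → 0ℤ + - (A * (+ 4 * x)) ≡ + 2 * (- (+ 2 * A) * x)
    collect₁₀ = solve-∀
    collect₀₁ : ∀ B x → 0ℤ + B * (+ 4 * x) ≡ + 2 * (+ 2 * B * x)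
    collect₀₁ = solve-∀

  central-recurrence : ∀ a b →
    + suc (a ℕ.+ b) * central (suc a) b ≡ - (+ 2 * + suc (2 ℕ.* a)) * central a b ×
    + suc (a ℕ.+ b) * central a (suc b) ≡ + 2 * + suc (2 ℕ.* b) * central a b
  central-recurrence a b =
    two-term-recurrence (+ suc (2 ℕ.* a)) (+ suc (2 ℕ.* b)) (+ suc (a ℕ.+ b)) (central a b) _ _
      A+B≡2c (central-difference a b) (central-weighted a b)
    where
    [1+2a]+[1+2b]≡2[1+a+b] : ∀ a b → (1 ℕ.+ 2 ℕ.* a) ℕ.+ (1 ℕ.+ 2 ℕ.* b) ≡ 2 ℕ.* (1 ℕ.+ (a ℕ.+ b))
    [1+2a]+[1+2b]≡2[1+a+b] = ℕ-Solver.solve-∀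
    A+B≡2c : + suc (2 ℕ.* a) + + suc (2 ℕ.* b) ≡ + 2 * + suc (a ℕ.+ b)
    A+B≡2c = trans (cong +_ ([1+2a]+[1+2b]≡2[1+a+b] a b)) (ℤ.pos-* 2 (suc (a ℕ.+ b)))

  closed-form-step : ∀ m c ρ x x′ w κ → c * x′ ≡ ρ * x → x * w ≡ κ → x′ * (m * (c * w)) ≡ m * ρ * κ
  closed-form-step m c ρ x x′ w κ recurrence closed = begin
    x′ * (m * (c * w))   ≡⟨ regroup m c x′ w ⟩
    m * (c * x′) * w     ≡⟨ cong (λ y → m * y * w) recurrence ⟩
    m * (ρ * x) * w      ≡⟨ regroup′ m ρ x w ⟩
    m * ρ * (x * w)      ≡⟨ cong (m * ρ *_) closed ⟩
    m * ρ * κ            ∎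
    where
    open ≡-Reasoning
    regroup : ∀ m c x′ w → x′ * (m * (c * w)) ≡ m * (c * x′) * w
    regroup = solve-∀
    regroup′ : ∀ m ρ x w → m * (ρ * x) * w ≡ m * ρ * (x * w)
    regroup′ = solve-∀

  +!-suc : ∀ n → + (suc n !) ≡ + suc n * + (n !)
  +!-suc n = ℤ.pos-* (suc n) (n !)

  +[2*suc]! : ∀ n → + ((2 ℕ.* suc n) !) ≡ + 2 * + suc n * (+ suc (2 ℕ.* n) * + ((2 ℕ.* n) !))
  +[2*suc]! n = begin
    + ((2 ℕ.* suc n) !)                                  ≡⟨ cong (λ m → + (m !)) (2*-suc n) ⟩
    + (suc (suc (2 ℕ.* n)) !)                            ≡⟨ +!-suc (suc (2 ℕ.* n)) ⟩
    + suc (suc (2 ℕ.* n)) * + (suc (2 ℕ.* n) !)          ≡⟨ cong₂ _*_ (trans (cong +_ (sym (2*-suc n))) (ℤ.pos-* 2 (suc n))) (+!-suc (2 ℕ.* n)) ⟩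
    + 2 * + suc n * (+ suc (2 ℕ.* n) * + ((2 ℕ.* n) !))  ∎
    where open ≡-Reasoning

  central-closed-form : ∀ a b →
    central a b * (+ (a !) * + (b !) * + ((a ℕ.+ b) !)) ≡ sgn a * (+ ((2 ℕ.* a) !) * + ((2 ℕ.* b) !))
  central-closed-form zero    zero    = refl
  central-closed-form zero    (suc b) = begin
    central 0 (suc b) * (1ℤ * + (suc b !) * + (suc b !))
      ≡⟨ cong (λ y → central 0 (suc b) * (1ℤ * y * y)) (+!-suc b) ⟩
    central 0 (suc b) * (1ℤ * (m * Y) * (m * Y))
      ≡⟨ cong (central 0 (suc b) *_) (regroup m Y) ⟩
    central 0 (suc b) * (m * (m * (1ℤ * Y * Y)))
      ≡⟨ closed-form-step m m (+ 2 * B) (central 0 b) (central 0 (suc b)) _ _ (proj₂ (central-recurrence 0 b)) (central-closed-form 0 b) ⟩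
    m * (+ 2 * B) * (1ℤ * (1ℤ * G))
      ≡⟨ regroup′ m B G ⟩
    1ℤ * (1ℤ * (+ 2 * m * (B * G)))
      ≡⟨ cong (λ y → 1ℤ * (1ℤ * y)) (+[2*suc]! b) ⟨
    1ℤ * (1ℤ * + ((2 ℕ.* suc b) !))
      ∎
    where
    open ≡-Reasoning
    m B Y G : ℤ
    m = + suc b
    B = + suc (2 ℕ.* b)
    Y = + (b !)
    G = + ((2 ℕ.* b) !)
    regroup : ∀ m Y → 1ℤ * (m * Y) * (m * Y) ≡ m * (m * (1ℤ * Y * Y))
    regroup = solve-∀
    regroup′ : ∀ m B G → m * (+ 2 * B) * (1ℤ * (1ℤ * G)) ≡ 1ℤ * (1ℤ * (+ 2 * m * (B * G)))
    regroup′ = solve-∀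
  central-closed-form (suc a) b = begin
    central (suc a) b * (+ (suc a !) * Y * + (suc (a ℕ.+ b) !))
      ≡⟨ cong₂ (λ x z → central (suc a) b * (x * Y * z)) (+!-suc a) (+!-suc (a ℕ.+ b)) ⟩
    central (suc a) b * (m * X * Y * (c * Z))
      ≡⟨ cong (central (suc a) b *_) (regroup m c X Y Z) ⟩
    central (suc a) b * (m * (c * (X * Y * Z)))
      ≡⟨ closed-form-step m c (- (+ 2 * A)) (central a b) (central (suc a) b) _ _ (proj₁ (central-recurrence a b)) (central-closed-form a b) ⟩
    m * - (+ 2 * A) * (sgn a * (F * G))
      ≡⟨ regroup′ m A (sgn a) F G ⟩
    - sgn a * (+ 2 * m * (A * F) * G)
      ≡⟨ cong (λ y → - sgn a * (y * G)) (+[2*suc]! a) ⟨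
    - sgn a * (+ ((2 ℕ.* suc a) !) * G)
      ∎
    where
    open ≡-Reasoning
    m c A X Y Z F G : ℤ
    m = + suc a
    c = + suc (a ℕ.+ b)
    A = + suc (2 ℕ.* a)
    X = + (a !)
    Y = + (b !)
    Z = + ((a ℕ.+ b) !)
    F = + ((2 ℕ.* a) !)
    G = + ((2 ℕ.* b) !)
    regroup : ∀ m c X Y Z → m * X * Y * (c * Z) ≡ m * (c * (X * Y * Z))
    regroup = solve-∀
    regroup′ : ∀ m A s F G → m * - (+ 2 * A) * (s * (F * G)) ≡ - s * (+ 2 * m * (A * F) * G)
    regroup′ = solve-∀

  C*k!*[n∸k]!≡n! : ∀ {n k} → k ≤ n → (n C k) ℕ.* (k ! ℕ.* (n ∸ k) !) ≡ n !
  C*k!*[n∸k]!≡n! {n} {k} k≤n =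
    trans (cong (ℕ._* (k ! ℕ.* (n ∸ k) !)) (nCk≡n!/k![n-k]! k≤n)) (m/n*n≡m {{k !* (n ∸ k) !≢0}} (k![n∸k]!∣n! k≤n))

  4rCr*[r!*[2r]!*[r+2r]!]≡[2r]!*[2[2r]]! : ∀ r →
    ((4 ℕ.* r) C r) ℕ.* (r ! ℕ.* (2 ℕ.* r) ! ℕ.* (r ℕ.+ 2 ℕ.* r) !) ≡ (2 ℕ.* r) ! ℕ.* (2 ℕ.* (2 ℕ.* r)) !
  4rCr*[r!*[2r]!*[r+2r]!]≡[2r]!*[2[2r]]! r = begin
    ((4 ℕ.* r) C r) ℕ.* (r ! ℕ.* (2 ℕ.* r) ! ℕ.* (r ℕ.+ 2 ℕ.* r) !)  ≡⟨ regroup ((2 ℕ.* r) !) ((4 ℕ.* r) C r) (r !) ((r ℕ.+ 2 ℕ.* r) !) ⟨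
    (2 ℕ.* r) ! ℕ.* (((4 ℕ.* r) C r) ℕ.* (r ! ℕ.* (r ℕ.+ 2 ℕ.* r) !)) ≡⟨ cong (λ n → (2 ℕ.* r) ! ℕ.* (((4 ℕ.* r) C r) ℕ.* (r ! ℕ.* n !))) 4r∸r≡r+2r ⟨
    (2 ℕ.* r) ! ℕ.* (((4 ℕ.* r) C r) ℕ.* (r ! ℕ.* (4 ℕ.* r ∸ r) !))    ≡⟨ cong ((2 ℕ.* r) ! ℕ.*_) (C*k!*[n∸k]!≡n! (ℕ.m≤n*m r 4)) ⟩
    (2 ℕ.* r) ! ℕ.* (4 ℕ.* r) !                                        ≡⟨ cong (λ n → (2 ℕ.* r) ! ℕ.* n !) (2[2r]≡4r r) ⟨
    (2 ℕ.* r) ! ℕ.* (2 ℕ.* (2 ℕ.* r)) !                                ∎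
    where
    open ≡-Reasoning
    4r≡r+2r+r : ∀ r → 4 ℕ.* r ≡ r ℕ.+ 2 ℕ.* r ℕ.+ r
    4r≡r+2r+r = ℕ-Solver.solve-∀
    2[2r]≡4r : ∀ r → 2 ℕ.* (2 ℕ.* r) ≡ 4 ℕ.* r
    2[2r]≡4r = ℕ-Solver.solve-∀
    regroup : ∀ a c b d → a ℕ.* (c ℕ.* (b ℕ.* d)) ≡ c ℕ.* (b ℕ.* a ℕ.* d)
    regroup = ℕ-Solver.solve-∀
    4r∸r≡r+2r : 4 ℕ.* r ∸ r ≡ r ℕ.+ 2 ℕ.* r
    4r∸r≡r+2r = trans (cong (_∸ r) (4r≡r+2r+r r)) (ℕ.m+n∸n≡m (r ℕ.+ 2 ℕ.* r) r)

  central-r-2r : ∀ r → central r (2 ℕ.* r) ≡ sgn r * + ((4 ℕ.* r) C r)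
  central-r-2r r = ℤ.*-cancelʳ-≡ _ _ (+ w) {{nonZero}} (begin
    central r (2 ℕ.* r) * + w                            ≡⟨ cong (central r (2 ℕ.* r) *_) (+-*³ (r !) ((2 ℕ.* r) !) ((r ℕ.+ 2 ℕ.* r) !)) ⟩
    central r (2 ℕ.* r) * (+ (r !) * + ((2 ℕ.* r) !) * + ((r ℕ.+ 2 ℕ.* r) !))
                                                         ≡⟨ central-closed-form r (2 ℕ.* r) ⟩
    sgn r * (+ ((2 ℕ.* r) !) * + ((2 ℕ.* (2 ℕ.* r)) !))  ≡⟨ cong (sgn r *_) (ℤ.pos-* ((2 ℕ.* r) !) _) ⟨
    sgn r * + ((2 ℕ.* r) ! ℕ.* (2 ℕ.* (2 ℕ.* r)) !)      ≡⟨ cong (λ x → sgn r * + x) (4rCr*[r!*[2r]!*[r+2r]!]≡[2r]!*[2[2r]]! r) ⟨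
    sgn r * + (((4 ℕ.* r) C r) ℕ.* w)                    ≡⟨ cong (sgn r *_) (ℤ.pos-* ((4 ℕ.* r) C r) w) ⟩
    sgn r * (+ ((4 ℕ.* r) C r) * + w)                    ≡⟨ ℤ.*-assoc (sgn r) _ (+ w) ⟨
    sgn r * + ((4 ℕ.* r) C r) * + w                      ∎)
    where
    open ≡-Reasoning
    w : ℕ
    w = r ! ℕ.* (2 ℕ.* r) ! ℕ.* (r ℕ.+ 2 ℕ.* r) !
    nonZero : ℕ.NonZero w
    nonZero = m*n≢0 (r ! ℕ.* (2 ℕ.* r) !) ((r ℕ.+ 2 ℕ.* r) !) {{r !* (2 ℕ.* r) !≢0}} {{(r ℕ.+ 2 ℕ.* r) !≢0}}
    +-*³ : ∀ x y z → + (x ℕ.* y ℕ.* z) ≡ + x * + y * + z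
    +-*³ x y z = trans (ℤ.pos-* (x ℕ.* y) z) (cong (_* + z) (ℤ.pos-* x y))

module Quadrinomial where

  open import Data.Nat.Base as ℕ using (zero; suc)
  import Data.Nat.Properties as ℕ
  open import Data.Integer.Base using (1ℤ)
  open import Relation.Binary.PropositionalEquality
  open FormalPowerSeries
  open Alternation
  open Palindromes
  open Coefficients
  open CentralCoefficients

  q : Series
  q = 𝟙 ⊕ t ⊕ t ^ 2 ⊕ t ^ 3

  series-quad : series quad ≋ q
  series-quad = ≋-trans coefficients (≋-sym (⊕-cong (⊕-congˡ {𝟙 ⊕ t} (t^≋shiftBy 2)) (t^≋shiftBy 3)))
    where
    coefficients : series quad ≋ 𝟙 ⊕ t ⊕ shiftBy 2 𝟙 ⊕ shiftBy 3 𝟙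
    coefficients 0                         = refl
    coefficients 1                         = refl
    coefficients 2                         = refl
    coefficients 3                         = refl
    coefficients (suc (suc (suc (suc k)))) = refl

  q≋[1+t]⊛[1+t²] : q ≋ (𝟙 ⊕ t ^ 1) ⊛ (𝟙 ⊕ t ^ 2)
  q≋[1+t]⊛[1+t²] = solve 1 (λ y → con 1ℤ :+ y :+ y :^ 2 :+ y :^ 3 := (con 1ℤ :+ y :^ 1) :* (con 1ℤ :+ y :^ 2)) ≋-refl t

  q^-palindromic : ∀ n → Palindromic (3 ℕ.* n) (q ^ n)
  q^-palindromic zero    = 𝟙-palindromic
  q^-palindromic (suc n) = subst (λ d → Palindromic d (q ^ suc n)) (sym (ℕ.*-suc 3 n))
    (palindromic-cong regroup (palindromic-1+t^-⊛ 1 (palindromic-1+t^-⊛ 2 (q^-palindromic n))))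
    where
    regroup : (𝟙 ⊕ t ^ 1) ⊛ ((𝟙 ⊕ t ^ 2) ⊛ q ^ n) ≋ q ^ suc n
    regroup = ≋-trans (≋-sym (⊛-assoc (𝟙 ⊕ t ^ 1) (𝟙 ⊕ t ^ 2) (q ^ n))) (⊛-cong (≋-sym q≋[1+t]⊛[1+t²]) ≋-refl)

  alternate-q : alternate q ≋ 𝟙 ⊕ ⊝ t ⊕ (⊝ t) ^ 2 ⊕ (⊝ t) ^ 3
  alternate-q = begin
    alternate (𝟙 ⊕ t ⊕ t ^ 2 ⊕ t ^ 3)
      ≈⟨ ≋-trans (alternate-⊕ (𝟙 ⊕ t ⊕ t ^ 2) (t ^ 3)) (⊕-congʳ (≋-trans (alternate-⊕ (𝟙 ⊕ t) (t ^ 2)) (⊕-congʳ (alternate-⊕ 𝟙 t)))) ⟩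
    alternate 𝟙 ⊕ alternate t ⊕ alternate (t ^ 2) ⊕ alternate (t ^ 3)
      ≈⟨ ⊕-cong (⊕-cong (⊕-cong alternate-𝟙 alternate-t) (alternate-^ t 2)) (alternate-^ t 3) ⟩
    𝟙 ⊕ ⊝ t ⊕ alternate t ^ 2 ⊕ alternate t ^ 3
      ≈⟨ ⊕-cong (⊕-congˡ {𝟙 ⊕ ⊝ t} (^-congˡ 2 alternate-t)) (^-congˡ 3 alternate-t) ⟩
    𝟙 ⊕ ⊝ t ⊕ (⊝ t) ^ 2 ⊕ (⊝ t) ^ 3
      ∎
    where open ≋-Reasoning

  alternate-q⊛q : alternate q ⊛ q ≋ U ⊛ V ^ 2
  alternate-q⊛q = ≋-trans (⊛-cong alternate-q ≋-refl)
    (solve 1 (λ y → (con 1ℤ :+ :- y :+ (:- y) :^ 2 :+ (:- y) :^ 3) :* (con 1ℤ :+ y :+ y :^ 2 :+ y :^ 3)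
                    := (con 1ℤ :+ :- (y :^ 2)) :* (con 1ℤ :+ y :^ 2) :^ 2) ≋-refl t)

  alternate-q^⊛q^ : ∀ n → alternate (q ^ n) ⊛ q ^ n ≋ U ^ n ⊛ V ^ (2 ℕ.* n)
  alternate-q^⊛q^ n = begin
    alternate (q ^ n) ⊛ q ^ n    ≈⟨ ⊛-cong (alternate-^ q n) ≋-refl ⟩
    alternate q ^ n ⊛ q ^ n      ≈⟨ ^-distrib-* (alternate q) q n ⟨
    (alternate q ⊛ q) ^ n        ≈⟨ ^-congˡ n alternate-q⊛q ⟩
    (U ⊛ V ^ 2) ^ n              ≈⟨ ^-distrib-* U (V ^ 2) n ⟩
    U ^ n ⊛ (V ^ 2) ^ n          ≈⟨ ⊛-cong {U ^ n} ≋-refl (^-assocʳ V 2 n) ⟩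
    U ^ n ⊛ V ^ (2 ℕ.* n)        ∎
    where open ≋-Reasoning

open import Data.Nat using (ℕ; _*_)
open import Data.Nat.Combinatorics using (_C_)
open import Data.Integer using (ℤ; +_)
open import Relation.Binary.PropositionalEquality using (_≡_)
import Data.Integer as ℤ

open import Data.Nat using (_+_)
open import Data.Nat.Tactic.RingSolver using (solve-∀)
import Data.Integer.Properties as ℤ
open import Relation.Binary.PropositionalEquality using (sym; cong; subst; module ≡-Reasoning)
open FormalPowerSeries using (Series; _≋_; _⊛_; _^_; ⊛-cong; ≋-trans; ≋-sym; ^-congˡ)
open Alternation using (alternate; alternate-cong)
open Palindromes using (Palindromic; palindromic-cong)
open Coefficients using (series; series-powP; sumTo-cong; alternating-sum-of-squares)
open CentralCoefficients using (U; V; central; central-r-2r)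
open Quadrinomial using (q; series-quad; q^-palindromic; alternate-q^⊛q^)

mainTheorem12 : (r : ℕ) →
    sumTo (6 * r) (λ k → sgn k ℤ.* (+ (binom3 (2 * r) k * binom3 (2 * r) k)))
      ≡ sgn r ℤ.* (+ ((4 * r) C r))
mainTheorem12 r = begin
  sumTo (6 * r) (λ k → sgn k ℤ.* (+ (binom3 (2 * r) k * binom3 (2 * r) k)))
    ≡⟨ sumTo-cong (6 * r) (λ k _ → cong (sgn k ℤ.*_) (ℤ.pos-* (binom3 (2 * r) k) (binom3 (2 * r) k))) ⟩
  sumTo (6 * r) (λ k → sgn k ℤ.* (F k ℤ.* F k))
    ≡⟨ alternating-sum-of-squares F-palindromic ⟩
  (alternate F ⊛ F) (6 * r)
    ≡⟨ ≋-trans (⊛-cong (alternate-cong F≋q^2r) F≋q^2r) (alternate-q^⊛q^ (2 * r)) (6 * r) ⟩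
  (U ^ (2 * r) ⊛ V ^ (2 * (2 * r))) (6 * r)
    ≡⟨ cong (U ^ (2 * r) ⊛ V ^ (2 * (2 * r))) (6r≡2[r+2r] r) ⟩
  central r (2 * r)
    ≡⟨ central-r-2r r ⟩
  sgn r ℤ.* + ((4 * r) C r)
    ∎
  where
  open ≡-Reasoning
  6r≡2[r+2r] : ∀ r → 6 * r ≡ 2 * (r + 2 * r)
  6r≡2[r+2r] = solve-∀
  6r≡3[2r] : ∀ r → 6 * r ≡ 3 * (2 * r)
  6r≡3[2r] = solve-∀
  F : Series
  F = series (powP quad (2 * r))
  F≋q^2r : F ≋ q ^ (2 * r)
  F≋q^2r = ≋-trans (series-powP quad (2 * r)) (^-congˡ (2 * r) series-quad)
  F-palindromic : Palindromic (6 * r) F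
  F-palindromic = subst (λ d → Palindromic d F) (sym (6r≡3[2r] r)) (palindromic-cong (≋-sym F≋q^2r) (q^-palindromic (2 * r)))
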